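{- Let $T$ be a signed tree and let $T'$ be a signed tree obtained from $T$ by one of the following operations: (i) changing simultaneously the signs of all vertices (i.e. $T'$ has the same edges, with $V'^-=V^+$ and $V'^+=V^-$); (ii) relabeling: $T'$ is the image of $T$ under a bijection $V\to V'$ onto another signed set preserving signs; (iii) applying a graph automorphism $\phi$ of the underlying tree of $T$ to the signs, i.e. $T'$ has the same edges and each $v$ gets in $T'$ the sign that $\phi(v)$ has in $T$; (iv) changing the sign of a single leaf of $T$; (v) switching two adjacent vertices $x,y$ of $T$, each of degree at most $2$, i.e. $T'$ has the same signed vertex set and its edge set is obtained from that of $T$ by applying the transposition exchanging $x$ and $y$. Then the signed nested complexes $\mathcal{N}(T)$ and $\mathcal{N}(T')$ are isomorphic simplicial complexes.
   Context: A signed tree is a tree $T$ whose vertex set $V$ is partitioned as $V=V^-\sqcup V^+$. $B\subseteq V$ is negative (resp. positive) convex in $T$ if every negative (resp. positive) vertex on the path in $T$ between two vertices of $B$ lies in $B$. A signed building block is a $B\subseteq V$ that is negative convex with $V\setminus B$ positive convex; $\mathcal{B}(T)$ is their set; those other than $\emptyset,V$ are relevant. Relevant $B_1,B_2$ are signed compatible if $B_1\subseteq B_2$, or $B_2\subseteq B_1$, or ($B_1\cap B_2=\emptyset$ and $B_1\cup B_2\notin\mathcal{B}(T)$), or ($B_1\cup B_2=V$ and $B_1\cap B_2\notin\mathcal{B}(T)$). The signed nested complex $\mathcal{N}(T)$ is the simplicial complex with vertex set the relevant signed building blocks whose faces are the sets of pairwise signed compatible ones. -}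

module Defs where

open import Data.Nat using (ℕ; _≤_)
open import Data.Bool using (Bool; true; false; not; if_then_else_)
open import Data.Fin using (Fin; _≟_)
open import Data.Fin.Subset using (Subset; _∈_; _⊆_; _∩_; _∪_; ∁; ∣_∣) renaming (⊥ to ∅; ⊤ to Full)
open import Data.Vec using (tabulate)
open import Data.List using (List; []; _∷_; _∷ʳ_; map)
open import Data.List.Relation.Unary.All using (All)
open import Data.List.Relation.Unary.Linked using (Linked)
open import Data.List.Relation.Unary.Unique.Propositional using (Unique)
import Data.List.Membership.Propositional as LM
open import Data.Product using (Σ; ∃; _×_)
open import Data.Sum using (_⊎_)
open import Relation.Nullary using (¬_; does)
open import Relation.Binary.PropositionalEquality using (_≡_)
open import Function.Bundles using (_↔_; Inverse)

Adj : ∀ {n} → (Fin n → Fin n → Bool) → Fin n → Fin n → Set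
Adj adj u v = adj u v ≡ true

IsPath : ∀ {n} → (Fin n → Fin n → Bool) → Fin n → Fin n → List (Fin n) → Set
IsPath adj a b p =
  (∃ λ q → p ≡ a ∷ q) × (∃ λ q → p ≡ q ∷ʳ b) × Linked (Adj adj) p × Unique p

record IsTree {n : ℕ} (adj : Fin n → Fin n → Bool) : Set where
  field
    symmetric   : ∀ u v → adj u v ≡ adj v u
    irreflexive : ∀ v → adj v v ≡ false
    connected   : ∀ a b → ∃ λ p → IsPath adj a b p
    uniquePaths : ∀ a b p q → IsPath adj a b p → IsPath adj a b q → p ≡ q

-- A signed tree on Fin n.  sign v ≡ true means v ∈ V⁺, false means v ∈ V⁻.
record SignedTree (n : ℕ) : Set where
  field
    adj    : Fin n → Fin n → Bool
    isTree : IsTree adj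
    sign   : Fin n → Bool
open SignedTree public

OnPath : ∀ {n} → SignedTree n → Fin n → Fin n → Fin n → Set
OnPath T a b v = ∃ λ p → IsPath (adj T) a b p × LM._∈_ v p

NegConvex : ∀ {n} → SignedTree n → Subset n → Set
NegConvex T B = ∀ a b v → a ∈ B → b ∈ B → OnPath T a b v → sign T v ≡ false → v ∈ B

PosConvex : ∀ {n} → SignedTree n → Subset n → Set
PosConvex T B = ∀ a b v → a ∈ B → b ∈ B → OnPath T a b v → sign T v ≡ true → v ∈ B

BuildingBlock : ∀ {n} → SignedTree n → Subset n → Set
BuildingBlock T B = NegConvex T B × PosConvex T (∁ B)

Relevant : ∀ {n} → SignedTree n → Subset n → Set
Relevant T B = BuildingBlock T B × ¬ (B ≡ ∅) × ¬ (B ≡ Full)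

SignedCompatible : ∀ {n} → SignedTree n → Subset n → Subset n → Set
SignedCompatible T B₁ B₂ =
  B₁ ⊆ B₂ ⊎ B₂ ⊆ B₁
  ⊎ (B₁ ∩ B₂ ≡ ∅ × ¬ BuildingBlock T (B₁ ∪ B₂))
  ⊎ (B₁ ∪ B₂ ≡ Full × ¬ BuildingBlock T (B₁ ∩ B₂))

Face : ∀ {n} → SignedTree n → List (Subset n) → Set
Face T S = All (Relevant T) S × All (λ B₁ → All (λ B₂ → SignedCompatible T B₁ B₂) S) S

record NestedIso {n m : ℕ} (T : SignedTree n) (T' : SignedTree m) : Set where
  field
    to       : Subset n → Subset m
    from     : Subset m → Subset n
    to-rel   : ∀ B → Relevant T B → Relevant T' (to B)
    from-rel : ∀ B → Relevant T' B → Relevant T (from B)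
    from-to  : ∀ B → Relevant T B → from (to B) ≡ B
    to-from  : ∀ B → Relevant T' B → to (from B) ≡ B
    faces    : ∀ S → All (Relevant T) S →
               (Face T S → Face T' (map to S)) × (Face T' (map to S) → Face T S)

degree : ∀ {n} → SignedTree n → Fin n → ℕ
degree T v = ∣ tabulate (λ u → adj T v u) ∣

IsLeaf : ∀ {n} → SignedTree n → Fin n → Set
IsLeaf T v = degree T v ≡ 1

swap : ∀ {n} → Fin n → Fin n → Fin n → Fin n
swap x y v = if does (v ≟ x) then y else (if does (v ≟ y) then x else v)

data Operation : ∀ {n m} → SignedTree n → SignedTree m → Set where
  flipAll : ∀ {n} (T T' : SignedTree n) →
    (∀ u v → adj T' u v ≡ adj T u v) →
    (∀ v → sign T' v ≡ not (sign T v)) →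
    Operation T T'
  relabel : ∀ {n m} (T : SignedTree n) (T' : SignedTree m) (φ : Fin n ↔ Fin m) →
    (∀ u v → adj T' (Inverse.to φ u) (Inverse.to φ v) ≡ adj T u v) →
    (∀ v → sign T' (Inverse.to φ v) ≡ sign T v) →
    Operation T T'
  automorphism : ∀ {n} (T T' : SignedTree n) (φ : Fin n ↔ Fin n) →
    (∀ u v → adj T (Inverse.to φ u) (Inverse.to φ v) ≡ adj T u v) →
    (∀ u v → adj T' u v ≡ adj T u v) →
    (∀ v → sign T' v ≡ sign T (Inverse.to φ v)) →
    Operation T T'
  flipLeaf : ∀ {n} (T T' : SignedTree n) (ℓ : Fin n) → IsLeaf T ℓ →
    (∀ u v → adj T' u v ≡ adj T u v) →
    sign T' ℓ ≡ not (sign T ℓ) →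
    (∀ v → ¬ (v ≡ ℓ) → sign T' v ≡ sign T v) →
    Operation T T'
  switch : ∀ {n} (T T' : SignedTree n) (x y : Fin n) →
    adj T x y ≡ true → degree T x ≤ 2 → degree T y ≤ 2 →
    (∀ u v → adj T' (swap x y u) (swap x y v) ≡ adj T u v) →
    (∀ v → sign T' v ≡ sign T v) →
    Operation T T'

-- Each operation is realised by a bijection between relevant building blocks that preserves and
-- reflects signed compatibility, which is an isomorphism of the nested complexes.  Flipping all
-- signs exchanges negative and positive convexity, so complementation works; relabellings and
-- automorphisms act by preimage; and the sign of a leaf is irrelevant, as a leaf is never an
-- interior vertex of a path.  A switch of x and y is a relabelling by the transposition after
-- exchanging the signs of x and y.  When x ∈ V⁻ and y ∈ V⁺, the component Y of y in T minus the
-- edge xy is the only building block containing y but not x; it is sent to the component of x,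
-- and every other block B to its image under the transposition.  This works because of the
-- degree bound: a path through y (resp. x) as an interior vertex also passes through x (resp. y).

module Submission where

open import Defs
open import Data.Nat using (ℕ; _≤_; z≤n; s≤s)
open import Data.Nat.Properties using (≤-trans)
open import Data.Bool using (Bool; true; false; not)
open import Data.Bool.Properties using (not-involutive; not-injective)
import Data.Bool
open import Data.Fin using (Fin; _≟_)
open import Data.Fin.Subset using (Subset; _∈_; _∉_; _⊆_; _∩_; _∪_; ∁; ∣_∣) renaming (⊥ to ∅; ⊤ to Full)
open import Data.Fin.Subset.Properties
  using (∉⊥; ∈⊤; Empty-unique; ⊆-refl; ⊆-antisym; _∈?_; ∩-comm; ∪-comm; ∪-∩-booleanAlgebra; p⊆q⇒∁p⊇∁q;
         x∈p∪q⁺; x∈p∪q⁻; x∈p∩q⁺; x∈p∩q⁻; x∈∁p⇒x∉p; x∉p⇒x∈∁p; x∈p∧x≢y⇒x∈p-y; x∈p⇒∣p-x∣<∣p∣)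
open import Data.Vec using (tabulate)
open import Data.Vec.Properties using (lookup∘tabulate; lookup⇒[]=; []=⇒lookup; ≡-dec)
open import Data.List using (List; []; _∷_; _++_; _∷ʳ_; [_]; length; map; reverse; reverseAcc)
open import Data.List.Properties using (∷ʳ-injectiveˡ; map-++)
open import Data.List.Relation.Unary.All as All using (All; []; _∷_)
import Data.List.Relation.Unary.All.Properties as All
open import Data.List.Relation.Unary.AllPairs using ([]; _∷_)
open import Data.List.Relation.Unary.Any using (here; there)
import Data.List.Relation.Unary.Any.Properties as Any
open import Data.List.Relation.Unary.Linked as Linked using (Linked; [-]; _∷_)
import Data.List.Relation.Unary.Linked.Properties as Linked
import Data.List.Relation.Unary.Unique.Propositional.Properties as Unique
open import Data.List.Membership.Propositional using () renaming (_∈_ to _∈ₗ_; _∉_ to _∉ₗ_)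
open import Data.List.Membership.Propositional.Properties using (∈-∃++; ∈-++⁺ʳ; ∈-++⁻; ∈-map⁺)
import Data.List.Membership.DecPropositional as DecMembership
open import Data.Product using (∃; ∃₂; _×_; _,_; proj₁; proj₂)
import Data.Product
open import Data.Sum using (_⊎_; inj₁; inj₂; [_,_]′)
import Data.Sum
open import Data.Empty using (⊥; ⊥-elim)
open import Function.Base using (_∘_; id)
open import Function.Bundles using (_⇔_; mk⇔; _↔_; Equivalence; Inverse)
open import Relation.Nullary using (¬_; Dec; yes; no; does)
open import Relation.Nullary.Decidable using (dec-true)
open import Relation.Unary using (Decidable)
open import Relation.Binary.PropositionalEquality
  using (_≡_; _≢_; refl; sym; trans; subst; subst₂; cong; cong₂; ≢-sym)
import Algebra.Lattice.Properties.BooleanAlgebra as BooleanAlgebraProperties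

module _ {A : Set} where

  open import Data.List.Relation.Unary.Unique.Propositional {A = A} using (Unique)

  data Last : List A → A → Set where
    last-here  : ∀ {b} → Last (b ∷ []) b
    last-there : ∀ {a l b} → Last l b → Last (a ∷ l) b

  ∷ʳ⇒Last : ∀ q {b} → Last (q ∷ʳ b) b
  ∷ʳ⇒Last []      = last-here
  ∷ʳ⇒Last (_ ∷ q) = last-there (∷ʳ⇒Last q)

  Last⇒∷ʳ : ∀ {p b} → Last p b → ∃ λ q → p ≡ q ∷ʳ b
  Last⇒∷ʳ last-here = [] , refl
  Last⇒∷ʳ (last-there {a = a} l) with Last⇒∷ʳ l
  ... | q , refl = a ∷ q , refl

  Last⇒∈ : ∀ {p b} → Last p b → b ∈ₗ p
  Last⇒∈ last-here      = here refl
  Last⇒∈ (last-there l) = there (Last⇒∈ l)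

  Last-suffix : ∀ r {v s b} → Last (r ++ v ∷ s) b → Last (v ∷ s) b
  Last-suffix []          l              = l
  Last-suffix (_ ∷ [])    (last-there l) = l
  Last-suffix (_ ∷ _ ∷ r) (last-there l) = Last-suffix (_ ∷ r) l

  Last-reverseAcc : ∀ acc l {a} → Last acc a → Last (reverseAcc acc l) a
  Last-reverseAcc acc []      h = h
  Last-reverseAcc acc (x ∷ l) h = Last-reverseAcc (x ∷ acc) l (last-there h)

  reverseAcc-head : ∀ acc {l b} → Last l b → ∃ λ q → reverseAcc acc l ≡ b ∷ q
  reverseAcc-head acc last-here                 = acc , refl
  reverseAcc-head acc (last-there {a = a} l) = reverseAcc-head (a ∷ acc) l

  Unique-reverseAcc : ∀ acc l → Unique acc → Unique l →
                      (∀ {v} → v ∈ₗ acc → v ∈ₗ l → ⊥) → Unique (reverseAcc acc l)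
  Unique-reverseAcc acc []      ua ul disj = ua
  Unique-reverseAcc acc (x ∷ l) ua (x∉l ∷ ul) disj =
    Unique-reverseAcc (x ∷ acc) l
      (All.tabulate (λ v∈acc x≡v → disj (subst (_∈ₗ acc) (sym x≡v) v∈acc) (here refl)) ∷ ua) ul
      λ { (here refl) v∈l → All.lookup x∉l v∈l refl ; (there v∈acc) v∈l → disj v∈acc (there v∈l) }

  Linked-reverseAcc : ∀ {R : A → A → Set} → (∀ {u v} → R u v → R v u) →
                      ∀ {a} acc l → Linked R (a ∷ acc) → Linked R (a ∷ l) →
                      Linked R (reverseAcc acc (a ∷ l))
  Linked-reverseAcc R-sym acc []      la _          = la
  Linked-reverseAcc R-sym acc (x ∷ l) la (r ∷ ll) = Linked-reverseAcc R-sym _ l (R-sym r ∷ la) ll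

  Linked-suffix : ∀ {R : A → A → Set} r {v s} → Linked R (r ++ v ∷ s) → Linked R (v ∷ s)
  Linked-suffix []      h = h
  Linked-suffix (_ ∷ r) h = Linked-suffix r (Linked.tail h)

  Linked-prefix : ∀ {R : A → A → Set} r {v s} → Linked R (r ++ v ∷ s) → Linked R (r ++ [ v ])
  Linked-prefix []          h        = [-]
  Linked-prefix (_ ∷ [])    (e ∷ _) = e ∷ [-]
  Linked-prefix (_ ∷ _ ∷ r) (e ∷ h) = e ∷ Linked-prefix (_ ∷ r) h

  Unique-suffix : ∀ r {v s} → Unique (r ++ v ∷ s) → Unique (v ∷ s)
  Unique-suffix []      h        = h
  Unique-suffix (_ ∷ r) (_ ∷ h) = Unique-suffix r h

  All-prefix : ∀ {P : A → Set} r {v s} → All P (r ++ v ∷ s) → All P (r ++ [ v ])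
  All-prefix []      (p ∷ _)  = p ∷ []
  All-prefix (_ ∷ r) (p ∷ ps) = p ∷ All-prefix r ps

  Unique-prefix : ∀ r {v s} → Unique (r ++ v ∷ s) → Unique (r ++ [ v ])
  Unique-prefix []      _         = [] ∷ []
  Unique-prefix (_ ∷ r) (px ∷ h) = All-prefix r px ∷ Unique-prefix r h

  Unique-split : ∀ r {v s x} → Unique (r ++ v ∷ s) → x ∈ₗ r → x ∉ₗ s
  Unique-split (_ ∷ r) (px ∷ _) (here refl) x∈s = All.lookup px (∈-++⁺ʳ r (there x∈s)) refl
  Unique-split (_ ∷ r) (_ ∷ u)  (there x∈r) x∈s = Unique-split r u x∈r x∈s

  head∈prefix : ∀ r {a v : A} {s q} → r ++ v ∷ s ≡ a ∷ q → a ≢ v → a ∈ₗ r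
  head∈prefix []      refl a≢v = ⊥-elim (a≢v refl)
  head∈prefix (_ ∷ r) refl _   = here refl

module _ {n : ℕ} where

  open BooleanAlgebraProperties (∪-∩-booleanAlgebra n)
    using ()
    renaming ( ¬-involutive to ∁-involutive; deMorgan₁ to ∁-∩; deMorgan₂ to ∁-∪
             ; ¬⊥≈⊤ to ∁-∅; ¬⊤≈⊥ to ∁-Full) public

  ≡∅⇒∉ : ∀ {p : Subset n} {x} → p ≡ ∅ → x ∉ p
  ≡∅⇒∉ refl = ∉⊥

  ∉⇒≡∅ : ∀ {p : Subset n} → (∀ x → x ∉ p) → p ≡ ∅
  ∉⇒≡∅ ∉p = Empty-unique λ (x , x∈p) → ∉p x x∈p

  ≡Full⇒∈ : ∀ {p : Subset n} {x} → p ≡ Full → x ∈ p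
  ≡Full⇒∈ refl = ∈⊤

  ∈⇒≡Full : ∀ {p : Subset n} → (∀ x → x ∈ p) → p ≡ Full
  ∈⇒≡Full ∈p = ⊆-antisym (λ _ → ∈⊤) (λ {x} _ → ∈p x)

  subset : (P : Fin n → Set) → Decidable P → Subset n
  subset P P? = tabulate (does ∘ P?)

  ∈-subset⁺ : ∀ {P : Fin n → Set} (P? : Decidable P) {x} → P x → x ∈ subset P P?
  ∈-subset⁺ P? {x} px = lookup⇒[]= x _ (trans (lookup∘tabulate _ x) (dec-true (P? x) px))

  ∈-subset⁻ : ∀ {P : Fin n → Set} (P? : Decidable P) {x} → x ∈ subset P P? → P x
  ∈-subset⁻ P? {x} x∈ with P? x | trans (sym (lookup∘tabulate (does ∘ P?) x)) ([]=⇒lookup x∈)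
  ... | yes px | _  = px
  ... | no  _  | ()

-- Abstract so that membership is only ever read off through ∈-preimage⁺/⁻, whose implicit
-- arguments can then be inferred.
abstract

  preimage : ∀ {n m} → (Fin m → Fin n) → Subset n → Subset m
  preimage h B = subset (λ z → h z ∈ B) (λ z → h z ∈? B)

  ∈-preimage⁺ : ∀ {n m} {h : Fin m → Fin n} {B x} → h x ∈ B → x ∈ preimage h B
  ∈-preimage⁺ {h = h} {B} = ∈-subset⁺ (λ z → h z ∈? B)

  ∈-preimage⁻ : ∀ {n m} {h : Fin m → Fin n} {B x} → x ∈ preimage h B → h x ∈ B
  ∈-preimage⁻ {h = h} {B} = ∈-subset⁻ (λ z → h z ∈? B)

module _ {n m : ℕ} (h : Fin m → Fin n) where

  preimage-∪ : ∀ B₁ B₂ → preimage h (B₁ ∪ B₂) ≡ preimage h B₁ ∪ preimage h B₂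
  preimage-∪ B₁ B₂ = ⊆-antisym
    (λ x∈ → x∈p∪q⁺ (Data.Sum.map ∈-preimage⁺ ∈-preimage⁺ (x∈p∪q⁻ B₁ B₂ (∈-preimage⁻ x∈))))
    (λ x∈ → ∈-preimage⁺ (x∈p∪q⁺ (Data.Sum.map ∈-preimage⁻ ∈-preimage⁻ (x∈p∪q⁻ _ _ x∈))))

  preimage-∩ : ∀ B₁ B₂ → preimage h (B₁ ∩ B₂) ≡ preimage h B₁ ∩ preimage h B₂
  preimage-∩ B₁ B₂ = ⊆-antisym
    (λ x∈ → x∈p∩q⁺ (Data.Product.map ∈-preimage⁺ ∈-preimage⁺ (x∈p∩q⁻ B₁ B₂ (∈-preimage⁻ x∈))))
    (λ x∈ → ∈-preimage⁺ (x∈p∩q⁺ (Data.Product.map ∈-preimage⁻ ∈-preimage⁻ (x∈p∩q⁻ _ _ x∈))))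

  preimage-⊆ : ∀ {B₁ B₂} → B₁ ⊆ B₂ → preimage h B₁ ⊆ preimage h B₂
  preimage-⊆ B₁⊆B₂ x∈ = ∈-preimage⁺ (B₁⊆B₂ (∈-preimage⁻ x∈))

  preimage-∅ : preimage h ∅ ≡ ∅
  preimage-∅ = ∉⇒≡∅ λ _ x∈ → ∉⊥ (∈-preimage⁻ x∈)

  preimage-Full : preimage h Full ≡ Full
  preimage-Full = ∈⇒≡Full λ _ → ∈-preimage⁺ ∈⊤

preimage-inverse : ∀ {n m} {f : Fin n → Fin m} {g : Fin m → Fin n} → (∀ x → g (f x) ≡ x) →
                   ∀ B → preimage f (preimage g B) ≡ B
preimage-inverse {g = g} g∘f B = ⊆-antisym
  (λ {x} x∈ → subst (_∈ B) (g∘f x) (∈-preimage⁻ (∈-preimage⁻ x∈)))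
  (λ {x} x∈ → ∈-preimage⁺ (∈-preimage⁺ (subst (_∈ B) (sym (g∘f x)) x∈)))

preimage-∅⁻ : ∀ {n m} {h : Fin m → Fin n} {k : Fin n → Fin m} → (∀ z → h (k z) ≡ z) →
              ∀ {B} → preimage h B ≡ ∅ → B ≡ ∅
preimage-∅⁻ {k = k} hk {B} pre≡∅ =
  ∉⇒≡∅ λ z z∈B → ≡∅⇒∉ pre≡∅ (∈-preimage⁺ {x = k z} (subst (_∈ B) (sym (hk z)) z∈B))

preimage-Full⁻ : ∀ {n m} {h : Fin m → Fin n} {k : Fin n → Fin m} → (∀ z → h (k z) ≡ z) →
                 ∀ {B} → preimage h B ≡ Full → B ≡ Full
preimage-Full⁻ {k = k} hk {B} pre≡Full =
  ∈⇒≡Full λ z → subst (_∈ B) (hk z) (∈-preimage⁻ {x = k z} (≡Full⇒∈ pre≡Full))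

-- Paths in a tree

module TreePaths {n : ℕ} (T : SignedTree n) where

  open IsTree (isTree T)
  open import Data.List.Relation.Unary.Unique.Propositional {A = Fin n} using (Unique)
  open DecMembership (_≟_ {n}) using () renaming (_∈?_ to _∈ₗ?_)

  Edge : Fin n → Fin n → Set
  Edge = Adj (adj T)

  Path : Fin n → Fin n → List (Fin n) → Set
  Path = IsPath (adj T)

  Edge-sym : ∀ {u v} → Edge u v → Edge v u
  Edge-sym {u} {v} e = trans (symmetric v u) e

  Edge⇒≢ : ∀ {u v} → Edge u v → u ≢ v
  Edge⇒≢ {u} e refl with trans (sym e) (irreflexive u)
  ... | ()

  path : ∀ {a b q} → Linked Edge (a ∷ q) → Last (a ∷ q) b → Unique (a ∷ q) → Path a b (a ∷ q)
  path lnk lst unq = (_ , refl) , Last⇒∷ʳ lst , lnk , unq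

  path-head : ∀ {a b p} → Path a b p → ∃ λ q → p ≡ a ∷ q
  path-head (hd , _) = hd

  path-last : ∀ {a b p} → Path a b p → Last p b
  path-last (_ , (q , refl) , _) = ∷ʳ⇒Last q

  path-linked : ∀ {a b p} → Path a b p → Linked Edge p
  path-linked (_ , _ , lnk , _) = lnk

  path-unique : ∀ {a b p} → Path a b p → Unique p
  path-unique (_ , _ , _ , unq) = unq

  start∈path : ∀ {a b p} → Path a b p → a ∈ₗ p
  start∈path pa with path-head pa
  ... | _ , refl = here refl

  end∈path : ∀ {a b p} → Path a b p → b ∈ₗ p
  end∈path pa = Last⇒∈ (path-last pa)

  path-[] : ∀ a → Path a a [ a ]
  path-[] a = path [-] last-here ([] ∷ [])

  path-edge : ∀ {a b} → Edge a b → Path a b (a ∷ b ∷ [])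
  path-edge e = path (e ∷ [-]) (last-there last-here) ((Edge⇒≢ e ∷ []) ∷ [] ∷ [])

  path-cons : ∀ {w a b p} → Edge w a → w ∉ₗ p → Path a b p → Path w b (w ∷ p)
  path-cons e w∉p pa with path-head pa
  ... | _ , refl = path (e ∷ path-linked pa) (last-there (path-last pa))
                        (All.tabulate (λ v∈p w≡v → w∉p (subst (_∈ₗ _) (sym w≡v) v∈p)) ∷ path-unique pa)

  path-suffix : ∀ {a b} r {v s} → Path a b (r ++ v ∷ s) → Path v b (v ∷ s)
  path-suffix r pa = path (Linked-suffix r (path-linked pa)) (Last-suffix r (path-last pa))
                          (Unique-suffix r (path-unique pa))

  path-prefix : ∀ {a b} r {v s} → Path a b (r ++ v ∷ s) → Path a v (r ++ [ v ])
  path-prefix [] pa with path-head pa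
  ... | _ , refl = path-[] _
  path-prefix (x ∷ r) pa with path-head pa
  ... | _ , refl = path (Linked-prefix (x ∷ r) (path-linked pa)) (∷ʳ⇒Last (x ∷ r))
                        (Unique-prefix (x ∷ r) (path-unique pa))

  path-reverse : ∀ {a b p} → Path a b p → Path b a (reverse p)
  path-reverse {a} {b} pa with path-head pa
  ... | q , refl with reverseAcc-head [] (path-last pa)
  ... | q′ , eq = subst (Path b a) (sym eq)
    (path (subst (Linked Edge) eq (Linked-reverseAcc Edge-sym [] q [-] (path-linked pa)))
          (subst (λ r → Last r a) eq (Last-reverseAcc [ a ] q last-here))
          (subst Unique eq (Unique-reverseAcc [] (a ∷ q) [] (path-unique pa) λ ())))

  onPath⇒∈ : ∀ {a b v p} → OnPath T a b v → Path a b p → v ∈ₗ p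
  onPath⇒∈ (q , pq , v∈q) pa = subst (_ ∈ₗ_) (uniquePaths _ _ _ _ pq pa) v∈q

  onPath-sym : ∀ {a b v} → OnPath T a b v → OnPath T b a v
  onPath-sym (p , pa , v∈p) = reverse p , path-reverse pa , Any.reverse⁺ v∈p

  onPath-end : ∀ a b → OnPath T a b b
  onPath-end a b = let (p , pa) = connected a b in p , pa , end∈path pa

  onPath? : ∀ a b v → Dec (OnPath T a b v)
  onPath? a b v with connected a b
  ... | p , pa with v ∈ₗ? p
  ...   | yes v∈p = yes (p , pa , v∈p)
  ...   | no  v∉p = no λ o → v∉p (onPath⇒∈ o pa)

  onPath-refl⁻ : ∀ {a v} → OnPath T a a v → v ≡ a
  onPath-refl⁻ o with onPath⇒∈ o (path-[] _)
  ... | here v≡a = v≡a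

  onPath-edge⁻ : ∀ {a b v} → Edge a b → OnPath T a b v → v ≡ a ⊎ v ≡ b
  onPath-edge⁻ e o with onPath⇒∈ o (path-edge e)
  ... | here v≡a         = inj₁ v≡a
  ... | there (here v≡b) = inj₂ v≡b

  path-extend : ∀ {a′ a z p} → Edge a′ a → Path a z p → a′ ∈ₗ p ⊎ Path a′ z (a′ ∷ p)
  path-extend {a′} {p = p} e pa with a′ ∈ₗ? p
  ... | yes a′∈p = inj₁ a′∈p
  ... | no  a′∉p = inj₂ (path-cons e a′∉p pa)

  -- Removing the edge u — w splits the tree into the w-side {z | OnPath T u z w}
  -- and the u-side {z | OnPath T w z u}.
  module EdgeSides {u w} (e : Edge u w) where

    side-dichotomy : ∀ z → OnPath T u z w ⊎ OnPath T w z u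
    side-dichotomy z with connected u z
    ... | p , pa with path-extend (Edge-sym e) pa
    ...   | inj₁ w∈p = inj₁ (p , pa , w∈p)
    ...   | inj₂ pa′ = inj₂ (w ∷ p , pa′ , there (start∈path pa))

    side-disjoint : ∀ {z} → OnPath T u z w → OnPath T w z u → ⊥
    side-disjoint (p , pa , w∈p) o with ∈-∃++ w∈p
    ... | r , s , refl with onPath⇒∈ o (path-suffix r pa)
    ...   | here u≡w  = Edge⇒≢ e u≡w
    ...   | there u∈s = Unique-split r (path-unique pa) (head∈prefix r (proj₂ (path-head pa)) (Edge⇒≢ e)) u∈s

    edge-crossing : ∀ {h h′} → Edge h h′ → OnPath T u h w → OnPath T w h′ u → h ≡ w × h′ ≡ u
    edge-crossing {h} eh oh oh′ with connected h w
    ... | p , pa with path-extend (Edge-sym eh) pa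
    ...   | inj₁ h′∈p with ∈-∃++ h′∈p
    ...     | r , s , refl = ⊥-elim (side-disjoint oh (onPath-sym
                (_ , pa , ∈-++⁺ʳ r (onPath⇒∈ (onPath-sym oh′) (path-suffix r pa)))))
    edge-crossing eh oh oh′ | p , pa | inj₂ pa′ with onPath⇒∈ (onPath-sym oh′) pa′
    ... | there u∈p = ⊥-elim (side-disjoint oh (onPath-sym (_ , pa , u∈p)))
    ... | here refl with onPath-edge⁻ (Edge-sym eh) oh
    ...   | inj₁ w≡h′ = ⊥-elim (Edge⇒≢ e (sym w≡h′))
    ...   | inj₂ w≡h  = sym w≡h , refl

    private
      crosses : ∀ {c t d} → Linked Edge (c ∷ t) → Last (c ∷ t) d →
                OnPath T u c w → OnPath T w d u → w ∈ₗ c ∷ t × u ∈ₗ c ∷ t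
      crosses {t = []}     _          last-here        oc od = ⊥-elim (side-disjoint oc od)
      crosses {t = h ∷ t} (ech ∷ lk) (last-there lst) oc od with side-dichotomy h
      ... | inj₁ oh = let (w∈ , u∈) = crosses lk lst oh od in there w∈ , there u∈
      ... | inj₂ oh with edge-crossing ech oc oh
      ...   | refl , refl = here refl , there (here refl)

      through : ∀ {c t v} → Linked Edge (c ∷ t) → OnPath T u c w → v ∈ₗ c ∷ t → OnPath T w v u →
                ∃₂ λ r s → c ∷ t ≡ r ++ u ∷ s × v ∈ₗ u ∷ s
      through _ oc (here refl) ov = ⊥-elim (side-disjoint oc ov)
      through {c} {h ∷ t} (ech ∷ lk) oc (there v∈) ov with side-dichotomy h
      ... | inj₁ oh = let (r , s , eq , v∈′) = through lk oh v∈ ov in c ∷ r , s , cong (c ∷_) eq , v∈′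
      ... | inj₂ oh with edge-crossing ech oc oh
      ...   | refl , refl = c ∷ [] , t , refl , v∈

    path-crosses-edge : ∀ {c d p} → Path c d p → OnPath T u c w → OnPath T w d u → w ∈ₗ p × u ∈ₗ p
    path-crosses-edge pa oc od with path-head pa
    ... | _ , refl = crosses (path-linked pa) (path-last pa) oc od

    path-through-edge : ∀ {c d p v} → Path c d p → OnPath T u c w → v ∈ₗ p → OnPath T w v u →
                        ∃₂ λ r s → p ≡ r ++ u ∷ s × v ∈ₗ u ∷ s
    path-through-edge pa oc v∈p ov with path-head pa
    ... | _ , refl = through (path-linked pa) oc v∈p ov

    onPath-move-start : ∀ {b v} → v ≢ u → v ≢ w → OnPath T u b v → OnPath T w b v
    onPath-move-start v≢u v≢w (p , pa , v∈p) with path-extend (Edge-sym e) pa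
    ... | inj₂ pa′ = w ∷ p , pa′ , there v∈p
    ... | inj₁ w∈p with ∈-∃++ w∈p
    ...   | r , s , refl with uniquePaths _ _ _ _ (path-prefix r pa) (path-edge e)
    ...     | r++w≡uw with ∷ʳ-injectiveˡ r (u ∷ []) r++w≡uw
    ...       | refl with v∈p
    ...         | here v≡u   = ⊥-elim (v≢u v≡u)
    ...         | there v∈ws = w ∷ s , path-suffix r pa , v∈ws

  module _ {u w} (e : Edge u w) where
    open EdgeSides e
    private module Opposite = EdgeSides (Edge-sym e)

    side-convex : ∀ {a b v} → OnPath T u a w → OnPath T u b w → OnPath T a b v → OnPath T u v w
    side-convex {a} {b} {v} oa ob (p , pa , v∈p) with side-dichotomy v
    ... | inj₁ ov = ov
    ... | inj₂ ov with ∈-∃++ v∈p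
    ...   | r , s , refl = ⊥-elim (Unique-split r (path-unique pa) w∈r w∈s)
      where
      w≢v : w ≢ v
      w≢v refl = side-disjoint (onPath-end u w) ov
      w∈r : w ∈ₗ r
      w∈r with ∈-++⁻ r (proj₁ (path-crosses-edge (path-prefix r pa) oa ov))
      ... | inj₁ w∈r          = w∈r
      ... | inj₂ (here w≡v) = ⊥-elim (w≢v w≡v)
      w∈s : w ∈ₗ s
      w∈s with proj₂ (Opposite.path-crosses-edge (path-suffix r pa) ov ob)
      ... | here w≡v   = ⊥-elim (w≢v w≡v)
      ... | there w∈s = w∈s

    side-cross : ∀ {a b v} → OnPath T u a w → OnPath T a b v → OnPath T u v w ⊎ OnPath T u b v
    side-cross {a} {b} {v} oa (p , pa , v∈p) with side-dichotomy v
    ... | inj₁ ov = inj₁ ov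
    ... | inj₂ ov with path-through-edge pa oa v∈p ov
    ...   | r , s , refl , v∈us = inj₂ (u ∷ s , path-suffix r pa , v∈us)

  private
    interior-neighbours′ : ∀ {h t b v} → Linked Edge (h ∷ t) → Unique (h ∷ t) → Last (h ∷ t) b →
                           v ∈ₗ h ∷ t → v ≢ h → v ≢ b →
                           ∃₂ λ c d → c ≢ d × Edge v c × Edge v d × c ∈ₗ h ∷ t × d ∈ₗ h ∷ t
    interior-neighbours′ _ _ _ (here v≡h) v≢h _ = ⊥-elim (v≢h v≡h)
    interior-neighbours′ {h} {h₂ ∷ t} {v = v} (e₁ ∷ lk) (h∉ ∷ un) (last-there lst) (there v∈) _ v≢b
      with v ≟ h₂
    interior-neighbours′ {t = _ ∷ []} _ _ (last-there last-here) _ _ v≢b | yes refl = ⊥-elim (v≢b refl)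
    interior-neighbours′ {h} {_ ∷ h₃ ∷ _} (e₁ ∷ e₂ ∷ _) (h∉ ∷ _) _ _ _ _ | yes refl =
      h , h₃ , All.lookup h∉ (there (here refl)) , Edge-sym e₁ , e₂ , here refl , there (there (here refl))
    ... | no v≢h₂ =
      let (c , d , c≢d , ec , ed , c∈ , d∈) = interior-neighbours′ lk un lst v∈ v≢h₂ v≢b
      in c , d , c≢d , ec , ed , there c∈ , there d∈

  interior-neighbours : ∀ {a b v} → OnPath T a b v → v ≢ a → v ≢ b →
                        ∃₂ λ c d → c ≢ d × Edge v c × Edge v d × OnPath T a b c × OnPath T a b d
  interior-neighbours (p , pa , v∈p) v≢a v≢b with path-head pa
  ... | _ , refl =
    let (c , d , c≢d , ec , ed , c∈ , d∈) =
          interior-neighbours′ (path-linked pa) (path-unique pa) (path-last pa) v∈p v≢a v≢b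
    in c , d , c≢d , ec , ed , (p , pa , c∈) , (p , pa , d∈)

module _ {n : ℕ} where
  open import Data.List.Relation.Unary.Unique.Propositional {A = Fin n} using (Unique)

  Unique⇒length≤∣p∣ : ∀ {p : Subset n} {xs} → Unique xs → All (_∈ p) xs → length xs ≤ ∣ p ∣
  Unique⇒length≤∣p∣ []              []            = z≤n
  Unique⇒length≤∣p∣ (x∉xs ∷ unique) (x∈p ∷ xs⊆p) =
    ≤-trans (s≤s (Unique⇒length≤∣p∣ unique
                   (All.zipWith (λ (y∈p , x≢y) → x∈p∧x≢y⇒x∈p-y y∈p (≢-sym x≢y)) (xs⊆p , x∉xs))))
            (x∈p⇒∣p-x∣<∣p∣ x∈p)

module _ {n : ℕ} (T : SignedTree n) where
  open TreePaths T

  neighbour∈ : ∀ {v c} → Edge v c → c ∈ tabulate (adj T v)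
  neighbour∈ {v} {c} e = lookup⇒[]= c _ (trans (lookup∘tabulate _ c) e)

  leaf-endpoint : ∀ {a b v} → IsLeaf T v → OnPath T a b v → v ≡ a ⊎ v ≡ b
  leaf-endpoint {a} {b} {v} leaf o with v ≟ a | v ≟ b
  ... | yes v≡a | _       = inj₁ v≡a
  ... | no _    | yes v≡b = inj₂ v≡b
  ... | no v≢a  | no v≢b with interior-neighbours o v≢a v≢b
  ...   | c , d , c≢d , ec , ed , _
        with subst (2 ≤_) leaf (Unique⇒length≤∣p∣ ((c≢d ∷ []) ∷ [] ∷ []) (neighbour∈ ec ∷ neighbour∈ ed ∷ []))
  ...     | s≤s ()

  degree≤2-interior : ∀ {a b v y} → degree T v ≤ 2 → Edge v y → OnPath T a b v → v ≢ a → v ≢ b →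
                      OnPath T a b y
  degree≤2-interior {y = y} deg e o v≢a v≢b with interior-neighbours o v≢a v≢b
  ... | c , d , c≢d , ec , ed , oc , od with y ≟ c | y ≟ d
  ...   | yes refl | _        = oc
  ...   | no _     | yes refl = od
  ...   | no y≢c   | no y≢d
        with ≤-trans (Unique⇒length≤∣p∣ ((c≢d ∷ ≢-sym y≢c ∷ []) ∷ (≢-sym y≢d ∷ []) ∷ [] ∷ [])
                                          (neighbour∈ ec ∷ neighbour∈ ed ∷ neighbour∈ e ∷ [])) deg
  ...     | s≤s (s≤s ())

-- Building blocks and isomorphisms of nested complexes

module _ {n : ℕ} {T : SignedTree n} where

  compatible-sym : ∀ {B₁ B₂} → SignedCompatible T B₁ B₂ → SignedCompatible T B₂ B₁
  compatible-sym (inj₁ B₁⊆B₂)         = inj₂ (inj₁ B₁⊆B₂)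
  compatible-sym (inj₂ (inj₁ B₂⊆B₁)) = inj₁ B₂⊆B₁
  compatible-sym {B₁} {B₂} (inj₂ (inj₂ (inj₁ (disjoint , ¬block)))) =
    inj₂ (inj₂ (inj₁ (trans (∩-comm B₂ B₁) disjoint , ¬block ∘ subst (BuildingBlock T) (∪-comm B₂ B₁))))
  compatible-sym {B₁} {B₂} (inj₂ (inj₂ (inj₂ (covering , ¬block)))) =
    inj₂ (inj₂ (inj₂ (trans (∪-comm B₂ B₁) covering , ¬block ∘ subst (BuildingBlock T) (∩-comm B₂ B₁))))

compatible-transfer : ∀ {n} {T T′ : SignedTree n} → (∀ D → BuildingBlock T′ D → BuildingBlock T D) →
                      ∀ {B₁ B₂} → SignedCompatible T B₁ B₂ → SignedCompatible T′ B₁ B₂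
compatible-transfer _       (inj₁ B₁⊆B₂)         = inj₁ B₁⊆B₂
compatible-transfer _       (inj₂ (inj₁ B₂⊆B₁)) = inj₂ (inj₁ B₂⊆B₁)
compatible-transfer reflect (inj₂ (inj₂ (inj₁ (disjoint , ¬block)))) =
  inj₂ (inj₂ (inj₁ (disjoint , ¬block ∘ reflect _)))
compatible-transfer reflect (inj₂ (inj₂ (inj₂ (covering , ¬block)))) =
  inj₂ (inj₂ (inj₂ (covering , ¬block ∘ reflect _)))

record BlockMap {n m} (T : SignedTree n) (T′ : SignedTree m) : Set where
  field
    apply      : Subset n → Subset m
    relevant   : ∀ {B} → Relevant T B → Relevant T′ (apply B)
    compatible : ∀ {B₁ B₂} → Relevant T B₁ → Relevant T B₂ →
                 SignedCompatible T B₁ B₂ → SignedCompatible T′ (apply B₁) (apply B₂)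

record BlockIso {n m} (T : SignedTree n) (T′ : SignedTree m) : Set where
  field
    to      : BlockMap T T′
    from    : BlockMap T′ T
    from∘to : ∀ {B} → Relevant T B → BlockMap.apply from (BlockMap.apply to B) ≡ B
    to∘from : ∀ {B} → Relevant T′ B → BlockMap.apply to (BlockMap.apply from B) ≡ B

_∘ᴹ_ : ∀ {n m k} {T₁ : SignedTree n} {T₂ : SignedTree m} {T₃ : SignedTree k} →
       BlockMap T₂ T₃ → BlockMap T₁ T₂ → BlockMap T₁ T₃
g ∘ᴹ f = record
  { apply      = G.apply ∘ F.apply
  ; relevant   = G.relevant ∘ F.relevant
  ; compatible = λ r₁ r₂ → G.compatible (F.relevant r₁) (F.relevant r₂) ∘ F.compatible r₁ r₂
  }
  where module F = BlockMap f; module G = BlockMap g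

BlockIso-trans : ∀ {n m k} {T₁ : SignedTree n} {T₂ : SignedTree m} {T₃ : SignedTree k} →
                 BlockIso T₁ T₂ → BlockIso T₂ T₃ → BlockIso T₁ T₃
BlockIso-trans I J = record
  { to      = J.to ∘ᴹ I.to
  ; from    = I.from ∘ᴹ J.from
  ; from∘to = λ r → trans (cong (BlockMap.apply I.from) (J.from∘to (BlockMap.relevant I.to r))) (I.from∘to r)
  ; to∘from = λ r → trans (cong (BlockMap.apply J.to) (I.to∘from (BlockMap.relevant J.from r))) (J.to∘from r)
  }
  where module I = BlockIso I; module J = BlockIso J

BlockIso⇒NestedIso : ∀ {n m} {T : SignedTree n} {T′ : SignedTree m} → BlockIso T T′ → NestedIso T T′
BlockIso⇒NestedIso {T = T} {T′} I = record
  { to       = To.apply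
  ; from     = From.apply
  ; to-rel   = λ _ → To.relevant
  ; from-rel = λ _ → From.relevant
  ; from-to  = λ _ → from∘to
  ; to-from  = λ _ → to∘from
  ; faces    = λ S rel → face⁺ S rel , face⁻ S rel
  }
  where
  open BlockIso I
  module To = BlockMap to
  module From = BlockMap from

  compatible-reflected : ∀ {B₁ B₂} → Relevant T B₁ → Relevant T B₂ →
                         SignedCompatible T′ (To.apply B₁) (To.apply B₂) → SignedCompatible T B₁ B₂
  compatible-reflected r₁ r₂ c =
    subst₂ (SignedCompatible T) (from∘to r₁) (from∘to r₂) (From.compatible (To.relevant r₁) (To.relevant r₂) c)

  face⁺ : ∀ S → All (Relevant T) S → Face T S → Face T′ (map To.apply S)
  face⁺ S rel (_ , pairwise) =
    All.map⁺ (All.map To.relevant rel) ,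
    All.map⁺ (All.tabulate λ B₁∈ → All.map⁺ (All.tabulate λ B₂∈ →
      To.compatible (All.lookup rel B₁∈) (All.lookup rel B₂∈) (All.lookup (All.lookup pairwise B₁∈) B₂∈)))

  face⁻ : ∀ S → All (Relevant T) S → Face T′ (map To.apply S) → Face T S
  face⁻ S rel (_ , pairwise) =
    rel ,
    All.tabulate λ B₁∈ → All.tabulate λ B₂∈ →
      compatible-reflected (All.lookup rel B₁∈) (All.lookup rel B₂∈)
        (All.lookup (All.map⁻ (All.lookup (All.map⁻ pairwise) B₁∈)) B₂∈)

-- Changing signs, complementing and relabelling

sameBlocksIso : ∀ {n} {T T′ : SignedTree n} →
                (∀ D → BuildingBlock T D → BuildingBlock T′ D) → (∀ D → BuildingBlock T′ D → BuildingBlock T D) →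
                BlockIso T T′
sameBlocksIso {n} to-block from-block = record
  { to = identity to-block from-block ; from = identity from-block to-block
  ; from∘to = λ _ → refl ; to∘from = λ _ → refl }
  where
  identity : ∀ {T₁ T₂ : SignedTree n} → (∀ D → BuildingBlock T₁ D → BuildingBlock T₂ D) →
             (∀ D → BuildingBlock T₂ D → BuildingBlock T₁ D) → BlockMap T₁ T₂
  identity {T₁} {T₂} forth back = record
    { apply      = id
    ; relevant   = λ (block , ≢∅ , ≢Full) → forth _ block , ≢∅ , ≢Full
    ; compatible = λ _ _ → compatible-transfer {T = T₁} {T₂} back
    }

onPath-transfer : ∀ {n} {T T′ : SignedTree n} → (∀ u v → adj T′ u v ≡ adj T u v) →
                  ∀ {a b v} → OnPath T′ a b v → OnPath T a b v
onPath-transfer same-adj (p , (hd , lst , lnk , unq) , v∈p) =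
  p , (hd , lst , Linked.map (λ {u} {v} e → trans (sym (same-adj u v)) e) lnk , unq) , v∈p

module _ {n : ℕ} {T T′ : SignedTree n} (same-adj : ∀ u v → adj T′ u v ≡ adj T u v) where

  private
    convex-transfer : ∀ {D : Subset n} {s s′} → (∀ v → sign T′ v ≡ s′ → sign T v ≡ s) →
      (∀ a b v → a ∈ D → b ∈ D → OnPath T a b v → sign T v ≡ s → v ∈ D) →
      (∀ a b v → a ∈ D → b ∈ D → OnPath T′ a b v → sign T′ v ≡ s′ → v ∈ D)
    convex-transfer sign⁻ convex a b v a∈ b∈ o s′ =
      convex a b v a∈ b∈ (onPath-transfer {T = T} {T′} same-adj o) (sign⁻ v s′)

  -- Convexity only constrains interior vertices of paths, so the other signs are irrelevant.
  interiorSigns-block : (∀ {a b v} → OnPath T a b v → v ≢ a → v ≢ b → sign T′ v ≡ sign T v) →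
                        ∀ D → BuildingBlock T D → BuildingBlock T′ D
  interiorSigns-block same-sign D (neg , pos) = convex neg , convex pos
    where
    convex : ∀ {E : Subset n} {s} → (∀ a b v → a ∈ E → b ∈ E → OnPath T a b v → sign T v ≡ s → v ∈ E) →
             (∀ a b v → a ∈ E → b ∈ E → OnPath T′ a b v → sign T′ v ≡ s → v ∈ E)
    convex conv a b v a∈ b∈ o s′ with v ≟ a | v ≟ b
    ... | yes refl | _        = a∈
    ... | no _     | yes refl = b∈
    ... | no v≢a   | no v≢b   =
      let o′ = onPath-transfer {T = T} {T′} same-adj o
      in conv a b v a∈ b∈ o′ (trans (sym (same-sign o′ v≢a v≢b)) s′)

  complement-block : (∀ v → sign T′ v ≡ not (sign T v)) → ∀ {D} → BuildingBlock T D → BuildingBlock T′ (∁ D)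
  complement-block flipped {D} (neg , pos) =
    convex-transfer sign-flipped pos , subst (PosConvex T′) (sym (∁-involutive D)) (convex-transfer sign-flipped neg)
    where
    sign-flipped : ∀ {s} v → sign T′ v ≡ not s → sign T v ≡ s
    sign-flipped v s′ = not-injective (trans (sym (flipped v)) s′)

interiorSignsIso : ∀ {n} {T T′ : SignedTree n} → (∀ u v → adj T′ u v ≡ adj T u v) →
                   (∀ {a b v} → OnPath T a b v → v ≢ a → v ≢ b → sign T′ v ≡ sign T v) → BlockIso T T′
interiorSignsIso {T = T} {T′} same-adj same-sign = sameBlocksIso
  (interiorSigns-block {T = T} {T′} same-adj same-sign)
  (interiorSigns-block {T = T′} {T} (λ u v → sym (same-adj u v))
    (λ o v≢a v≢b → sym (same-sign (onPath-transfer {T = T} {T′} same-adj o) v≢a v≢b)))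

flipped-sym : ∀ {n} {T T′ : SignedTree n} → (∀ v → sign T′ v ≡ not (sign T v)) →
              ∀ v → sign T v ≡ not (sign T′ v)
flipped-sym flipped v = trans (sym (not-involutive _)) (cong not (sym (flipped v)))

complementMap : ∀ {n} {T T′ : SignedTree n} → (∀ u v → adj T′ u v ≡ adj T u v) →
                (∀ v → sign T′ v ≡ not (sign T v)) → BlockMap T T′
complementMap {n} {T} {T′} same-adj flipped = record
  { apply      = ∁
  ; relevant   = λ (block , ≢∅ , ≢Full) →
      complement-block {T = T} {T′} same-adj flipped block , ≢Full ∘ ∁≡∅⇒≡Full , ≢∅ ∘ ∁≡Full⇒≡∅
  ; compatible = λ _ _ → compatible
  }
  where
  reflect : ∀ D → BuildingBlock T′ (∁ D) → BuildingBlock T D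
  reflect D = subst (BuildingBlock T) (∁-involutive D)
            ∘ complement-block {T = T′} {T} (λ u v → sym (same-adj u v)) (flipped-sym {T = T} {T′} flipped)
  ∁≡∅⇒≡Full : ∀ {B : Subset n} → ∁ B ≡ ∅ → B ≡ Full
  ∁≡∅⇒≡Full {B} ∁B≡∅ = trans (sym (∁-involutive B)) (trans (cong ∁ ∁B≡∅) ∁-∅)
  ∁≡Full⇒≡∅ : ∀ {B : Subset n} → ∁ B ≡ Full → B ≡ ∅
  ∁≡Full⇒≡∅ {B} ∁B≡Full = trans (sym (∁-involutive B)) (trans (cong ∁ ∁B≡Full) ∁-Full)
  compatible : ∀ {B₁ B₂} → SignedCompatible T B₁ B₂ → SignedCompatible T′ (∁ B₁) (∁ B₂)
  compatible (inj₁ B₁⊆B₂)         = inj₂ (inj₁ (p⊆q⇒∁p⊇∁q B₁⊆B₂))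
  compatible (inj₂ (inj₁ B₂⊆B₁)) = inj₁ (p⊆q⇒∁p⊇∁q B₂⊆B₁)
  compatible {B₁} {B₂} (inj₂ (inj₂ (inj₁ (disjoint , ¬block)))) = inj₂ (inj₂ (inj₂
    ( trans (sym (∁-∩ B₁ B₂)) (trans (cong ∁ disjoint) ∁-∅)
    , ¬block ∘ reflect (B₁ ∪ B₂) ∘ subst (BuildingBlock T′) (sym (∁-∪ B₁ B₂)))))
  compatible {B₁} {B₂} (inj₂ (inj₂ (inj₂ (covering , ¬block)))) = inj₂ (inj₂ (inj₁
    ( trans (sym (∁-∪ B₁ B₂)) (trans (cong ∁ covering) ∁-Full)
    , ¬block ∘ reflect (B₁ ∩ B₂) ∘ subst (BuildingBlock T′) (sym (∁-∩ B₁ B₂)))))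

complementIso : ∀ {n} {T T′ : SignedTree n} → (∀ u v → adj T′ u v ≡ adj T u v) →
                (∀ v → sign T′ v ≡ not (sign T v)) → BlockIso T T′
complementIso {T = T} {T′} same-adj flipped = record
  { to      = complementMap same-adj flipped
  ; from    = complementMap (λ u v → sym (same-adj u v)) (flipped-sym {T = T} {T′} flipped)
  ; from∘to = λ {B} _ → ∁-involutive B
  ; to∘from = λ {B} _ → ∁-involutive B
  }

module _ {n m : ℕ} {T : SignedTree n} {T′ : SignedTree m} (h : Fin m → Fin n) where

  preimage-compatible : ∀ {B₁ B₂} →
    (BuildingBlock T′ (preimage h (B₁ ∪ B₂)) → BuildingBlock T (B₁ ∪ B₂)) →
    (BuildingBlock T′ (preimage h (B₁ ∩ B₂)) → BuildingBlock T (B₁ ∩ B₂)) →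
    SignedCompatible T B₁ B₂ → SignedCompatible T′ (preimage h B₁) (preimage h B₂)
  preimage-compatible _ _ (inj₁ B₁⊆B₂)         = inj₁ (preimage-⊆ h B₁⊆B₂)
  preimage-compatible _ _ (inj₂ (inj₁ B₂⊆B₁)) = inj₂ (inj₁ (preimage-⊆ h B₂⊆B₁))
  preimage-compatible {B₁} {B₂} reflect∪ _ (inj₂ (inj₂ (inj₁ (disjoint , ¬block)))) = inj₂ (inj₂ (inj₁
    ( trans (sym (preimage-∩ h B₁ B₂)) (trans (cong (preimage h) disjoint) (preimage-∅ h))
    , ¬block ∘ reflect∪ ∘ subst (BuildingBlock T′) (sym (preimage-∪ h B₁ B₂)))))
  preimage-compatible {B₁} {B₂} _ reflect∩ (inj₂ (inj₂ (inj₂ (covering , ¬block)))) = inj₂ (inj₂ (inj₂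
    ( trans (sym (preimage-∪ h B₁ B₂)) (trans (cong (preimage h) covering) (preimage-Full h))
    , ¬block ∘ reflect∩ ∘ subst (BuildingBlock T′) (sym (preimage-∩ h B₁ B₂)))))

  preimage-block : (∀ {x y} → h x ≡ h y → x ≡ y) →
                   (∀ u v → adj T (h u) (h v) ≡ adj T′ u v) → (∀ v → sign T (h v) ≡ sign T′ v) →
                   ∀ {B} → BuildingBlock T B → BuildingBlock T′ (preimage h B)
  preimage-block injective h-adj h-sign (neg , pos) =
    (λ a b v a∈ b∈ o s → ∈-preimage⁺
      (neg _ _ _ (∈-preimage⁻ a∈) (∈-preimage⁻ b∈) (map-onPath o) (trans (h-sign v) s))) ,
    (λ a b v a∈ b∈ o s → x∉p⇒x∈∁p λ v∈ → x∈∁p⇒x∉p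
      (pos _ _ _ (∁-preimage a∈) (∁-preimage b∈) (map-onPath o) (trans (h-sign v) s)) (∈-preimage⁻ v∈))
    where
    ∁-preimage : ∀ {B x} → x ∈ ∁ (preimage h B) → h x ∈ ∁ B
    ∁-preimage x∈ = x∉p⇒x∈∁p λ hx∈B → x∈∁p⇒x∉p x∈ (∈-preimage⁺ hx∈B)
    map-path : ∀ {a b p} → IsPath (adj T′) a b p → IsPath (adj T) (h a) (h b) (map h p)
    map-path ((q , refl) , (r , p≡r∷ʳb) , lnk , unq) =
      (map h q , refl) , (map h r , trans (cong (map h) p≡r∷ʳb) (map-++ h r _)) ,
      Linked.map⁺ (Linked.map (λ {u} {v} e → trans (h-adj u v) e) lnk) , Unique.map⁺ injective unq
    map-onPath : ∀ {a b v} → OnPath T′ a b v → OnPath T (h a) (h b) (h v)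
    map-onPath (p , pa , v∈p) = map h p , map-path pa , ∈-map⁺ h v∈p

record SignedTreeIso {n m} (T : SignedTree n) (T′ : SignedTree m) : Set where
  field
    to      : Fin n → Fin m
    from    : Fin m → Fin n
    from∘to : ∀ x → from (to x) ≡ x
    to∘from : ∀ y → to (from y) ≡ y
    adj-to  : ∀ u v → adj T′ (to u) (to v) ≡ adj T u v
    sign-to : ∀ v → sign T′ (to v) ≡ sign T v

  to-injective : ∀ {x y} → to x ≡ to y → x ≡ y
  to-injective {x} {y} tx≡ty = trans (sym (from∘to x)) (trans (cong from tx≡ty) (from∘to y))

  inverse : SignedTreeIso T′ T
  inverse = record
    { to = from ; from = to ; from∘to = to∘from ; to∘from = from∘to
    ; adj-to  = λ u v → trans (sym (adj-to (from u) (from v))) (cong₂ (adj T′) (to∘from u) (to∘from v))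
    ; sign-to = λ v → trans (sym (sign-to (from v))) (cong (sign T′) (to∘from v))
    }

relabelMap : ∀ {n m} {T : SignedTree n} {T′ : SignedTree m} → SignedTreeIso T T′ → BlockMap T T′
relabelMap {n} {m} {T} {T′} φ = record
  { apply      = preimage from
  ; relevant   = λ (block , ≢∅ , ≢Full) →
      preimage-block {T = T} {T′} from from-injective adj-from sign-from block ,
      ≢∅ ∘ preimage-∅⁻ {h = from} {k = to} from∘to , ≢Full ∘ preimage-Full⁻ {h = from} {k = to} from∘to
  ; compatible = λ _ _ → preimage-compatible {T = T} {T′} from (reflect _) (reflect _)
  }
  where
  open SignedTreeIso φ
  open SignedTreeIso inverse using () renaming (to-injective to from-injective; adj-to to adj-from; sign-to to sign-from)
  reflect : ∀ D → BuildingBlock T′ (preimage from D) → BuildingBlock T D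
  reflect D = subst (BuildingBlock T) (preimage-inverse from∘to D) ∘ preimage-block {T = T′} {T} to to-injective adj-to sign-to

relabelIso : ∀ {n m} {T : SignedTree n} {T′ : SignedTree m} → SignedTreeIso T T′ → BlockIso T T′
relabelIso φ = record
  { to      = relabelMap φ
  ; from    = relabelMap (SignedTreeIso.inverse φ)
  ; from∘to = λ {B} _ → preimage-inverse (SignedTreeIso.from∘to φ) B
  ; to∘from = λ {B} _ → preimage-inverse (SignedTreeIso.to∘from φ) B
  }

signedTreeIso : ∀ {n m} {T : SignedTree n} {T′ : SignedTree m} (φ : Fin n ↔ Fin m) →
                (∀ u v → adj T′ (Inverse.to φ u) (Inverse.to φ v) ≡ adj T u v) →
                (∀ v → sign T′ (Inverse.to φ v) ≡ sign T v) → SignedTreeIso T T′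
signedTreeIso φ φ-adj φ-sign = record
  { to = Inverse.to φ ; from = Inverse.from φ
  ; from∘to = Inverse.strictlyInverseʳ φ ; to∘from = Inverse.strictlyInverseˡ φ
  ; adj-to = φ-adj ; sign-to = φ-sign }

-- The two sides of an edge

withSigns : ∀ {n} → SignedTree n → (Fin n → Bool) → SignedTree n
withSigns T s = record { adj = adj T ; isTree = isTree T ; sign = s }

-- For an edge u — w, side T u w is the component of w once the edge is removed.  Paths are
-- decided with the signs forgotten, so that side T u w depends on the edges of T only.
side : ∀ {n} → SignedTree n → Fin n → Fin n → Subset n
side T u w = subset (λ z → OnPath T u z w) (λ z → TreePaths.onPath? (withSigns T (λ _ → false)) u z w)

module EdgeSide {n : ℕ} (T : SignedTree n) {u w : Fin n} (e : TreePaths.Edge T u w) where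

  open TreePaths T hiding (onPath?)
  open EdgeSides e
  open TreePaths (withSigns T (λ _ → false)) using (onPath?)

  W U : Subset n
  W = side T u w
  U = side T w u

  ∈W⁺ : ∀ {z} → OnPath T u z w → z ∈ W
  ∈W⁺ = ∈-subset⁺ (λ z → onPath? u z w)

  ∈W⁻ : ∀ {z} → z ∈ W → OnPath T u z w
  ∈W⁻ = ∈-subset⁻ (λ z → onPath? u z w)

  ∈U⁺ : ∀ {z} → OnPath T w z u → z ∈ U
  ∈U⁺ = ∈-subset⁺ (λ z → onPath? w z u)

  ∈U⁻ : ∀ {z} → z ∈ U → OnPath T w z u
  ∈U⁻ = ∈-subset⁻ (λ z → onPath? w z u)

  ∈W⊎∈U : ∀ z → z ∈ W ⊎ z ∈ U
  ∈W⊎∈U z = Data.Sum.map ∈W⁺ ∈U⁺ (side-dichotomy z)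

  ∈W⇒∉U : ∀ {z} → z ∈ W → z ∉ U
  ∈W⇒∉U z∈W z∈U = side-disjoint (∈W⁻ z∈W) (∈U⁻ z∈U)

  ∉W⇒∈U : ∀ {z} → z ∉ W → z ∈ U
  ∉W⇒∈U {z} z∉W = [ (λ z∈W → ⊥-elim (z∉W z∈W)) , (λ z∈U → z∈U) ]′ (∈W⊎∈U z)

  ∉U⇒∈W : ∀ {z} → z ∉ U → z ∈ W
  ∉U⇒∈W {z} z∉U = [ (λ z∈W → z∈W) , (λ z∈U → ⊥-elim (z∉U z∈U)) ]′ (∈W⊎∈U z)

  w∈W : w ∈ W
  w∈W = ∈W⁺ (onPath-end u w)

  u∉W : u ∉ W
  u∉W u∈W = Edge⇒≢ e (sym (onPath-refl⁻ (∈W⁻ u∈W)))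

  W-convex : ∀ {a b v} → a ∈ W → b ∈ W → OnPath T a b v → v ∈ W
  W-convex a∈ b∈ o = ∈W⁺ (side-convex e (∈W⁻ a∈) (∈W⁻ b∈) o)

  U-convex : ∀ {a b v} → a ∈ U → b ∈ U → OnPath T a b v → v ∈ U
  U-convex a∈ b∈ o = ∈U⁺ (side-convex (Edge-sym e) (∈U⁻ a∈) (∈U⁻ b∈) o)

  W-block : BuildingBlock T W
  W-block = (λ _ _ _ a∈ b∈ o _ → W-convex a∈ b∈ o) ,
            (λ _ _ _ a∉ b∉ o _ → x∉p⇒x∈∁p λ v∈W →
               ∈W⇒∉U v∈W (U-convex (∉W⇒∈U (x∈∁p⇒x∉p a∉)) (∉W⇒∈U (x∈∁p⇒x∉p b∉)) o))

  W-relevant : Relevant T W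
  W-relevant = W-block , (λ W≡∅ → ≡∅⇒∉ W≡∅ w∈W) , (λ W≡Full → u∉W (≡Full⇒∈ W≡Full))

  W∪-block : ∀ {B} → BuildingBlock T B → u ∈ B → BuildingBlock T (W ∪ B)
  W∪-block {B} (neg , pos) u∈B = neg′ , pos′
    where
    mixed : ∀ {a b v} → a ∈ W → b ∈ B → OnPath T a b v → sign T v ≡ false → v ∈ W ∪ B
    mixed a∈W b∈B o s with side-cross e (∈W⁻ a∈W) o
    ... | inj₁ ov = x∈p∪q⁺ (inj₁ (∈W⁺ ov))
    ... | inj₂ ob = x∈p∪q⁺ (inj₂ (neg _ _ _ u∈B b∈B ob s))
    neg′ : NegConvex T (W ∪ B)
    neg′ a b v a∈ b∈ o s with x∈p∪q⁻ W B a∈ | x∈p∪q⁻ W B b∈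
    ... | inj₁ a∈W | inj₁ b∈W = x∈p∪q⁺ (inj₁ (W-convex a∈W b∈W o))
    ... | inj₂ a∈B | inj₂ b∈B = x∈p∪q⁺ (inj₂ (neg a b v a∈B b∈B o s))
    ... | inj₁ a∈W | inj₂ b∈B = mixed a∈W b∈B o s
    ... | inj₂ a∈B | inj₁ b∈W = mixed b∈W a∈B (onPath-sym o) s
    pos′ : PosConvex T (∁ (W ∪ B))
    pos′ a b v a∉ b∉ o s = x∉p⇒x∈∁p λ v∈ → [ (λ v∈W → ∈W⇒∉U v∈W (U-convex (outside-W a∉) (outside-W b∉) o))
                                          , (λ v∈B → x∈∁p⇒x∉p (pos a b v (outside-B a∉) (outside-B b∉) o s) v∈B)
                                          ]′ (x∈p∪q⁻ W B v∈)
      where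
      outside-W : ∀ {z} → z ∈ ∁ (W ∪ B) → z ∈ U
      outside-W z∉ = ∉W⇒∈U λ z∈W → x∈∁p⇒x∉p z∉ (x∈p∪q⁺ (inj₁ z∈W))
      outside-B : ∀ {z} → z ∈ ∁ (W ∪ B) → z ∈ ∁ B
      outside-B z∉ = x∉p⇒x∈∁p λ z∈B → x∈∁p⇒x∉p z∉ (x∈p∪q⁺ (inj₂ z∈B))

  W∩-block : ∀ {B} → BuildingBlock T B → w ∉ B → BuildingBlock T (W ∩ B)
  W∩-block {B} (neg , pos) w∉B = neg′ , pos′
    where
    neg′ : NegConvex T (W ∩ B)
    neg′ a b v a∈ b∈ o s =
      let (a∈W , a∈B) = x∈p∩q⁻ W B a∈; (b∈W , b∈B) = x∈p∩q⁻ W B b∈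
      in x∈p∩q⁺ (W-convex a∈W b∈W o , neg a b v a∈B b∈B o s)
    outside : ∀ {z} → z ∈ ∁ (W ∩ B) → z ∈ U ⊎ z ∈ ∁ B
    outside {z} z∉ with z ∈? B
    ... | yes z∈B = inj₁ (∉W⇒∈U λ z∈W → x∈∁p⇒x∉p z∉ (x∈p∩q⁺ (z∈W , z∈B)))
    ... | no  z∉B = inj₂ (x∉p⇒x∈∁p z∉B)
    inside : ∀ {z} → z ∈ U ⊎ z ∈ ∁ B → z ∈ ∁ (W ∩ B)
    inside (inj₁ z∈U)  = x∉p⇒x∈∁p λ z∈ → ∈W⇒∉U (proj₁ (x∈p∩q⁻ W B z∈)) z∈U
    inside (inj₂ z∉B) = x∉p⇒x∈∁p λ z∈ → x∈∁p⇒x∉p z∉B (proj₂ (x∈p∩q⁻ W B z∈))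
    mixed : ∀ {a b v} → a ∈ U → b ∈ ∁ B → OnPath T a b v → sign T v ≡ true → v ∈ U ⊎ v ∈ ∁ B
    mixed a∈U b∉B o s with side-cross (Edge-sym e) (∈U⁻ a∈U) o
    ... | inj₁ ov = inj₁ (∈U⁺ ov)
    ... | inj₂ ob = inj₂ (pos _ _ _ (x∉p⇒x∈∁p w∉B) b∉B ob s)
    pos′ : PosConvex T (∁ (W ∩ B))
    pos′ a b v a∉ b∉ o s with outside a∉ | outside b∉
    ... | inj₁ a∈U | inj₁ b∈U = inside (inj₁ (U-convex a∈U b∈U o))
    ... | inj₂ a∉B | inj₂ b∉B = inside (inj₂ (pos a b v a∉B b∉B o s))
    ... | inj₁ a∈U | inj₂ b∉B = inside (mixed a∈U b∉B o s)
    ... | inj₂ a∉B | inj₁ b∈U = inside (mixed b∈U a∉B (onPath-sym o) s)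

  W-incompatible : ∀ {B} → BuildingBlock T B → u ∈ B → w ∉ B → ¬ SignedCompatible T W B
  W-incompatible block u∈B w∉B (inj₁ W⊆B)                        = w∉B (W⊆B w∈W)
  W-incompatible block u∈B w∉B (inj₂ (inj₁ B⊆W))                 = u∉W (B⊆W u∈B)
  W-incompatible block u∈B w∉B (inj₂ (inj₂ (inj₁ (_ , ¬block)))) = ¬block (W∪-block block u∈B)
  W-incompatible block u∈B w∉B (inj₂ (inj₂ (inj₂ (_ , ¬block)))) = ¬block (W∩-block block w∉B)

  module _ (u⁻ : sign T u ≡ false) (w⁺ : sign T w ≡ true) where

    W-unique : ∀ {B} → BuildingBlock T B → w ∈ B → u ∉ B → B ≡ W
    W-unique {B} (neg , pos) w∈B u∉B = ⊆-antisym B⊆W W⊆B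
      where
      B⊆W : B ⊆ W
      B⊆W {z} z∈B = ∉U⇒∈W λ z∈U → u∉B (neg w z u w∈B z∈B (∈U⁻ z∈U) u⁻)
      W⊆B : W ⊆ B
      W⊆B {z} z∈W with z ∈? B
      ... | yes z∈B = z∈B
      ... | no  z∉B = ⊥-elim (x∈∁p⇒x∉p (pos u z w (x∉p⇒x∈∁p u∉B) (x∉p⇒x∈∁p z∉B) (∈W⁻ z∈W) w⁺) w∈B)

    compatible-W⇔∋uw : ∀ {B} → Relevant T B → u ∈ B → w ∈ B → SignedCompatible T W B ⇔ (W ⊆ B ⊎ U ⊆ B)
    compatible-W⇔∋uw {B} (block , _ , ≢Full) u∈B w∈B = mk⇔ to from
      where
      to : SignedCompatible T W B → W ⊆ B ⊎ U ⊆ B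
      to (inj₁ W⊆B)                            = inj₁ W⊆B
      to (inj₂ (inj₁ B⊆W))                     = ⊥-elim (u∉W (B⊆W u∈B))
      to (inj₂ (inj₂ (inj₁ (disjoint , _)))) = ⊥-elim (≡∅⇒∉ disjoint (x∈p∩q⁺ (w∈W , w∈B)))
      to (inj₂ (inj₂ (inj₂ (covering , _)))) =
        inj₂ λ z∈U → [ (λ z∈W → ⊥-elim (∈W⇒∉U z∈W z∈U)) , (λ z∈B → z∈B) ]′ (x∈p∪q⁻ W B (≡Full⇒∈ covering))
      from : W ⊆ B ⊎ U ⊆ B → SignedCompatible T W B
      from (inj₁ W⊆B) = inj₁ W⊆B
      from (inj₂ U⊆B) = inj₂ (inj₂ (inj₂
        ( ∈⇒≡Full (λ z → [ x∈p∪q⁺ ∘ inj₁ , x∈p∪q⁺ ∘ inj₂ ∘ U⊆B ]′ (∈W⊎∈U z))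
        , λ W∩B-block → ≢Full (∈⇒≡Full λ z →
            [ proj₂ ∘ x∈p∩q⁻ W B ∘ subst (z ∈_) (sym (W∩B≡W W∩B-block)) , U⊆B ]′ (∈W⊎∈U z)))))
        where
        W∩B≡W : BuildingBlock T (W ∩ B) → W ∩ B ≡ W
        W∩B≡W bb = W-unique bb (x∈p∩q⁺ (w∈W , w∈B)) (u∉W ∘ proj₁ ∘ x∈p∩q⁻ W B)

    compatible-W⇔∌uw : ∀ {B} → Relevant T B → u ∉ B → w ∉ B → SignedCompatible T W B ⇔ (B ⊆ W ⊎ B ⊆ U)
    compatible-W⇔∌uw {B} (block , ≢∅ , _) u∉B w∉B = mk⇔ to from
      where
      to : SignedCompatible T W B → B ⊆ W ⊎ B ⊆ U
      to (inj₁ W⊆B)                            = ⊥-elim (w∉B (W⊆B w∈W))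
      to (inj₂ (inj₁ B⊆W))                     = inj₁ B⊆W
      to (inj₂ (inj₂ (inj₁ (disjoint , _)))) = inj₂ λ z∈B → ∉W⇒∈U λ z∈W → ≡∅⇒∉ disjoint (x∈p∩q⁺ (z∈W , z∈B))
      to (inj₂ (inj₂ (inj₂ (covering , _)))) =
        ⊥-elim ([ u∉W , u∉B ]′ (x∈p∪q⁻ W B (≡Full⇒∈ covering)))
      from : B ⊆ W ⊎ B ⊆ U → SignedCompatible T W B
      from (inj₁ B⊆W) = inj₂ (inj₁ B⊆W)
      from (inj₂ B⊆U) = inj₂ (inj₂ (inj₁
        ( ∉⇒≡∅ (λ z z∈ → let (z∈W , z∈B) = x∈p∩q⁻ W B z∈ in ∈W⇒∉U z∈W (B⊆U z∈B))
        , λ W∪B-block → ≢∅ (∉⇒≡∅ λ z z∈B →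
            ∈W⇒∉U (subst (z ∈_) (W∪B≡W W∪B-block) (x∈p∪q⁺ (inj₂ z∈B))) (B⊆U z∈B)))))
        where
        W∪B≡W : BuildingBlock T (W ∪ B) → W ∪ B ≡ W
        W∪B≡W bb = W-unique bb (x∈p∪q⁺ (inj₁ w∈W)) ([ u∉W , u∉B ]′ ∘ x∈p∪q⁻ W B)

-- Exchanging the signs of two adjacent vertices of degree at most two

swap-x : ∀ {n} (x y : Fin n) → swap x y x ≡ y
swap-x x y with x ≟ x
... | yes _   = refl
... | no x≢x = ⊥-elim (x≢x refl)

swap-y : ∀ {n} (x y : Fin n) → swap x y y ≡ x
swap-y x y with y ≟ x
... | yes y≡x = y≡x
... | no _ with y ≟ y
...   | yes _   = refl
...   | no y≢y = ⊥-elim (y≢y refl)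

swap-other : ∀ {n} (x y : Fin n) {v} → v ≢ x → v ≢ y → swap x y v ≡ v
swap-other x y {v} v≢x v≢y with v ≟ x
... | yes v≡x = ⊥-elim (v≢x v≡x)
... | no _ with v ≟ y
...   | yes v≡y = ⊥-elim (v≢y v≡y)
...   | no _    = refl

data SwapCase {n} (x y v : Fin n) : Set where
  is-x  : v ≡ x → SwapCase x y v
  is-y  : v ≡ y → SwapCase x y v
  other : v ≢ x → v ≢ y → SwapCase x y v

swapCase : ∀ {n} (x y v : Fin n) → SwapCase x y v
swapCase x y v with v ≟ x | v ≟ y
... | yes v≡x | _       = is-x v≡x
... | no _    | yes v≡y = is-y v≡y
... | no v≢x  | no v≢y  = other v≢x v≢y

swap-swap : ∀ {n} (x y v : Fin n) → swap y x (swap x y v) ≡ v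
swap-swap x y v with swapCase x y v
... | is-x refl       = trans (cong (swap y x) (swap-x x y)) (swap-x y x)
... | is-y refl       = trans (cong (swap y x) (swap-y x y)) (swap-y y x)
... | other v≢x v≢y = trans (cong (swap y x) (swap-other x y v≢x v≢y)) (swap-other y x v≢y v≢x)

true≢false : true ≢ false
true≢false ()

module ExchangeBlocks {n : ℕ} (T : SignedTree n) (s : Fin n → Bool) {x y : Fin n}
  (x—y : TreePaths.Edge T x y) (deg-x : degree T x ≤ 2) (deg-y : degree T y ≤ 2)
  (x⁻ : sign T x ≡ false) (y⁺ : sign T y ≡ true) (s-x : s x ≡ true) (s-y : s y ≡ false)
  (s-other : ∀ {v} → v ≢ x → v ≢ y → s v ≡ sign T v) where

  open TreePaths T

  private
    T′ : SignedTree n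
    T′ = withSigns T s

  onPath-swap-start : ∀ {a b v} → v ≢ x → v ≢ y → OnPath T a b v → OnPath T (swap x y a) b v
  onPath-swap-start {a} {b} {v} v≢x v≢y o with swapCase x y a
  ... | is-x refl       = subst (λ z → OnPath T z b v) (sym (swap-x x y)) (EdgeSides.onPath-move-start x—y v≢x v≢y o)
  ... | is-y refl       = subst (λ z → OnPath T z b v) (sym (swap-y x y))
                                (EdgeSides.onPath-move-start (Edge-sym x—y) v≢y v≢x o)
  ... | other a≢x a≢y = subst (λ z → OnPath T z b v) (sym (swap-other x y a≢x a≢y)) o

  onPath-swap : ∀ {a b v} → v ≢ x → v ≢ y → OnPath T a b v → OnPath T (swap x y a) (swap x y b) v
  onPath-swap v≢x v≢y = onPath-sym ∘ onPath-swap-start v≢x v≢y ∘ onPath-sym ∘ onPath-swap-start v≢x v≢y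

  swap-unmoved : ∀ {P : Fin n → Set} {a} → P (swap x y a) → ¬ P x → ¬ P y → swap x y a ≡ a × a ≢ x × a ≢ y
  swap-unmoved {P} {a} p ¬px ¬py with swapCase x y a
  ... | is-x refl       = ⊥-elim (¬py (subst P (swap-x x y) p))
  ... | is-y refl       = ⊥-elim (¬px (subst P (swap-y x y) p))
  ... | other a≢x a≢y = swap-other x y a≢x a≢y , a≢x , a≢y

  -- Away from x and y the paths and signs are unchanged; at the interior vertex y (resp. x) of a
  -- path, degree ≤ 2 forces the path through x (resp. y) as well.
  swap-block : ∀ {D} → ¬ (y ∈ D × x ∉ D) → BuildingBlock T D → BuildingBlock T′ (preimage (swap x y) D)
  swap-block {D} exception (neg , pos) = neg′ , pos′
    where
    D′ = preimage (swap x y) D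

    x∈D : ∀ {a b} → a ∈ D′ → b ∈ D′ → OnPath T a b y → x ∈ D
    x∈D {a} {b} a∈ b∈ o with x ∈? D
    ... | yes x∈D = x∈D
    ... | no  x∉D =
      let y∉D = λ y∈D → exception (y∈D , x∉D)
          (sa≡a , a≢x , a≢y) = swap-unmoved (∈-preimage⁻ a∈) x∉D y∉D
          (sb≡b , b≢x , b≢y) = swap-unmoved (∈-preimage⁻ b∈) x∉D y∉D
      in neg a b x (subst (_∈ D) sa≡a (∈-preimage⁻ a∈)) (subst (_∈ D) sb≡b (∈-preimage⁻ b∈))
             (degree≤2-interior T deg-y (Edge-sym x—y) o (≢-sym a≢y) (≢-sym b≢y)) x⁻

    y∉D : ∀ {a b} → a ∈ ∁ D′ → b ∈ ∁ D′ → OnPath T a b x → y ∉ D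
    y∉D {a} {b} a∉ b∉ o y∈D with x ∈? D
    ... | no  x∉D = exception (y∈D , x∉D)
    ... | yes x∈D =
      let (sa≡a , a≢x , a≢y) = swap-unmoved {P = _∉ D} (outside a∉) (λ x∉D → x∉D x∈D) (λ y∉D → y∉D y∈D)
          (sb≡b , b≢x , b≢y) = swap-unmoved {P = _∉ D} (outside b∉) (λ x∉D → x∉D x∈D) (λ y∉D → y∉D y∈D)
      in x∈∁p⇒x∉p (pos a b y (x∉p⇒x∈∁p (subst (_∉ D) sa≡a (outside a∉))) (x∉p⇒x∈∁p (subst (_∉ D) sb≡b (outside b∉)))
                       (degree≤2-interior T deg-x x—y o (≢-sym a≢x) (≢-sym b≢x)) y⁺) y∈D
      where
      outside : ∀ {z} → z ∈ ∁ D′ → swap x y z ∉ D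
      outside z∉ sz∈D = x∈∁p⇒x∉p z∉ (∈-preimage⁺ sz∈D)

    neg′ : NegConvex T′ D′
    neg′ a b v a∈ b∈ o s′ with swapCase x y v
    ... | is-x refl       = ⊥-elim (true≢false (trans (sym s-x) s′))
    ... | is-y refl       = ∈-preimage⁺ (subst (_∈ D) (sym (swap-y x y)) (x∈D a∈ b∈ o))
    ... | other v≢x v≢y = ∈-preimage⁺ (subst (_∈ D) (sym (swap-other x y v≢x v≢y))
        (neg _ _ v (∈-preimage⁻ a∈) (∈-preimage⁻ b∈) (onPath-swap v≢x v≢y o) (trans (sym (s-other v≢x v≢y)) s′)))

    pos′ : PosConvex T′ (∁ D′)
    pos′ a b v a∉ b∉ o s′ with swapCase x y v
    ... | is-y refl       = ⊥-elim (true≢false (trans (sym s′) s-y))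
    ... | is-x refl       = x∉p⇒x∈∁p λ x∈D′ → y∉D a∉ b∉ o (subst (_∈ D) (swap-x x y) (∈-preimage⁻ x∈D′))
    ... | other v≢x v≢y = x∉p⇒x∈∁p λ v∈D′ → x∈∁p⇒x∉p
        (pos _ _ v (x∉p⇒x∈∁p (x∈∁p⇒x∉p a∉ ∘ ∈-preimage⁺)) (x∉p⇒x∈∁p (x∈∁p⇒x∉p b∉ ∘ ∈-preimage⁺))
             (onPath-swap v≢x v≢y o) (trans (sym (s-other v≢x v≢y)) s′))
        (subst (_∈ D) (swap-other x y v≢x v≢y) (∈-preimage⁻ v∈D′))

_≟ˢ_ : ∀ {n} (p q : Subset n) → Dec (p ≡ q)
_≟ˢ_ = ≡-dec Data.Bool._≟_

exchange : ∀ {n} → SignedTree n → Fin n → Fin n → Subset n → Subset n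
exchange T x y B with B ≟ˢ side T x y
... | yes _ = side T y x
... | no  _ = preimage (swap x y) B

exchange-side : ∀ {n} (T : SignedTree n) x y → exchange T x y (side T x y) ≡ side T y x
exchange-side T x y with side T x y ≟ˢ side T x y
... | yes _ = refl
... | no  ≢ = ⊥-elim (≢ refl)

exchange-other : ∀ {n} (T : SignedTree n) x y {B} → B ≢ side T x y → exchange T x y B ≡ preimage (swap x y) B
exchange-other T x y {B} B≢ with B ≟ˢ side T x y
... | yes B≡ = ⊥-elim (B≢ B≡)
... | no  _  = refl

module Exchange {n : ℕ} (T : SignedTree n) (s : Fin n → Bool) {x y : Fin n}
  (x—y : TreePaths.Edge T x y) (deg-x : degree T x ≤ 2) (deg-y : degree T y ≤ 2)
  (x⁻ : sign T x ≡ false) (y⁺ : sign T y ≡ true) (s-x : s x ≡ true) (s-y : s y ≡ false)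
  (s-other : ∀ {v} → v ≢ x → v ≢ y → s v ≡ sign T v) where

  open TreePaths T using (Edge-sym)

  private
    T′ : SignedTree n
    T′ = withSigns T s
    open ExchangeBlocks T s x—y deg-x deg-y x⁻ y⁺ s-x s-y s-other using (swap-block)
    module Back = ExchangeBlocks T′ (sign T) (Edge-sym x—y) deg-y deg-x s-y s-x y⁺ x⁻
                                 (λ v≢y v≢x → sym (s-other v≢x v≢y))
    module Y = EdgeSide T x—y
    module X = EdgeSide T′ (Edge-sym x—y)

  no-y-without-x : ∀ {B} → BuildingBlock T B → B ≢ side T x y → ¬ (y ∈ B × x ∉ B)
  no-y-without-x block B≢Y (y∈B , x∉B) = B≢Y (Y.W-unique x⁻ y⁺ block y∈B x∉B)

  swap-reflect : ∀ {D} → ¬ (y ∈ D × x ∉ D) → BuildingBlock T′ (preimage (swap x y) D) → BuildingBlock T D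
  swap-reflect {D} exception =
    subst (BuildingBlock T) (preimage-inverse {f = swap y x} {g = swap x y} (swap-swap y x) D) ∘ Back.swap-block exception′
    where
    exception′ : ¬ (x ∈ preimage (swap x y) D × y ∉ preimage (swap x y) D)
    exception′ (x∈ , y∉) = exception ( subst (_∈ D) (swap-x x y) (∈-preimage⁻ x∈)
                                       , λ x∈D → y∉ (∈-preimage⁺ (subst (_∈ D) (sym (swap-y x y)) x∈D)))

  swap-fixed : ∀ {B} → (x ∈ B → y ∈ B) → (y ∈ B → x ∈ B) → preimage (swap x y) B ≡ B
  swap-fixed {B} x⇒y y⇒x = ⊆-antisym forth back
    where
    forth : preimage (swap x y) B ⊆ B
    forth {z} z∈ with swapCase x y z
    ... | is-x refl       = y⇒x (subst (_∈ B) (swap-x x y) (∈-preimage⁻ z∈))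
    ... | is-y refl       = x⇒y (subst (_∈ B) (swap-y x y) (∈-preimage⁻ z∈))
    ... | other z≢x z≢y = subst (_∈ B) (swap-other x y z≢x z≢y) (∈-preimage⁻ z∈)
    back : B ⊆ preimage (swap x y) B
    back {z} z∈B with swapCase x y z
    ... | is-x refl       = ∈-preimage⁺ (subst (_∈ B) (sym (swap-x x y)) (x⇒y z∈B))
    ... | is-y refl       = ∈-preimage⁺ (subst (_∈ B) (sym (swap-y x y)) (y⇒x z∈B))
    ... | other z≢x z≢y = ∈-preimage⁺ (subst (_∈ B) (sym (swap-other x y z≢x z≢y)) z∈B)

  swap-relevant : ∀ {B} → Relevant T B → B ≢ side T x y → Relevant T′ (preimage (swap x y) B)
  swap-relevant (block , ≢∅ , ≢Full) B≢Y =
    swap-block (no-y-without-x block B≢Y) block ,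
    ≢∅ ∘ preimage-∅⁻ {h = swap x y} {k = swap y x} (swap-swap y x) ,
    ≢Full ∘ preimage-Full⁻ {h = swap x y} {k = swap y x} (swap-swap y x)

  exchange-relevant : ∀ {B} → Relevant T B → Relevant T′ (exchange T x y B)
  exchange-relevant {B} r with B ≟ˢ side T x y
  ... | yes _   = X.W-relevant
  ... | no B≢Y = swap-relevant r B≢Y

  -- Compatibility with a side is decided by how B meets x and y, and exchanging the
  -- signs of x and y exchanges the roles of the two sides.
  side-compatible : ∀ {B} → Relevant T B → B ≢ side T x y → SignedCompatible T (side T x y) B →
                    SignedCompatible T′ (side T y x) (preimage (swap x y) B)
  side-compatible {B} r B≢Y c with x ∈? B | y ∈? B
  ... | yes x∈B | yes y∈B =
    subst (SignedCompatible T′ (side T y x)) (sym fixed)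
      (Equivalence.from (X.compatible-W⇔∋uw s-y s-x r′ y∈B x∈B)
        (Data.Sum.swap (Equivalence.to (Y.compatible-W⇔∋uw x⁻ y⁺ r x∈B y∈B) c)))
    where
    fixed = swap-fixed (λ _ → y∈B) (λ _ → x∈B)
    r′ = subst (Relevant T′) fixed (swap-relevant r B≢Y)
  ... | no x∉B | no y∉B =
    subst (SignedCompatible T′ (side T y x)) (sym fixed)
      (Equivalence.from (X.compatible-W⇔∌uw s-y s-x r′ y∉B x∉B)
        (Data.Sum.swap (Equivalence.to (Y.compatible-W⇔∌uw x⁻ y⁺ r x∉B y∉B) c)))
    where
    fixed = swap-fixed (⊥-elim ∘ x∉B) (⊥-elim ∘ y∉B)
    r′ = subst (Relevant T′) fixed (swap-relevant r B≢Y)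
  ... | yes x∈B | no y∉B = ⊥-elim (Y.W-incompatible (proj₁ r) x∈B y∉B c)
  ... | no x∉B | yes y∈B = ⊥-elim (no-y-without-x (proj₁ r) B≢Y (y∈B , x∉B))

  exchange-compatible : ∀ {B₁ B₂} → Relevant T B₁ → Relevant T B₂ → SignedCompatible T B₁ B₂ →
                        SignedCompatible T′ (exchange T x y B₁) (exchange T x y B₂)
  exchange-compatible {B₁} {B₂} r₁ r₂ c with B₁ ≟ˢ side T x y | B₂ ≟ˢ side T x y
  ... | yes _    | yes _    = inj₁ ⊆-refl
  ... | yes refl | no B₂≢Y = side-compatible r₂ B₂≢Y c
  ... | no B₁≢Y | yes refl = compatible-sym {T = T′} (side-compatible r₁ B₁≢Y (compatible-sym {T = T} c))
  ... | no B₁≢Y | no B₂≢Y =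
    preimage-compatible {T = T} {T′} (swap x y) (swap-reflect exception∪) (swap-reflect exception∩) c
    where
    exception₁ = no-y-without-x (proj₁ r₁) B₁≢Y
    exception₂ = no-y-without-x (proj₁ r₂) B₂≢Y
    exception∪ : ¬ (y ∈ B₁ ∪ B₂ × x ∉ B₁ ∪ B₂)
    exception∪ (y∈ , x∉) = [ (λ y∈B₁ → exception₁ (y∈B₁ , x∉ ∘ x∈p∪q⁺ ∘ inj₁))
                           , (λ y∈B₂ → exception₂ (y∈B₂ , x∉ ∘ x∈p∪q⁺ ∘ inj₂)) ]′ (x∈p∪q⁻ B₁ B₂ y∈)
    exception∩ : ¬ (y ∈ B₁ ∩ B₂ × x ∉ B₁ ∩ B₂)
    exception∩ (y∈ , x∉) with x∈p∩q⁻ B₁ B₂ y∈ | x ∈? B₁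
    ... | y∈B₁ , _    | no x∉B₁  = exception₁ (y∈B₁ , x∉B₁)
    ... | _    , y∈B₂ | yes x∈B₁ = exception₂ (y∈B₂ , λ x∈B₂ → x∉ (x∈p∩q⁺ (x∈B₁ , x∈B₂)))

  exchangeMap : BlockMap T T′
  exchangeMap = record
    { apply = exchange T x y ; relevant = exchange-relevant ; compatible = exchange-compatible }

  exchange-inverse : ∀ {B} → Relevant T B → exchange T′ y x (exchange T x y B) ≡ B
  exchange-inverse {B} r with B ≟ˢ side T x y
  ... | yes refl = exchange-side T′ y x
  ... | no B≢Y  = trans (exchange-other T′ y x swapped≢X) (preimage-inverse {f = swap y x} {g = swap x y} (swap-swap y x) B)
    where
    swapped≢X : preimage (swap x y) B ≢ side T y x
    swapped≢X eq = no-y-without-x (proj₁ r) B≢Y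
      ( subst (_∈ B) (swap-x x y) (∈-preimage⁻ (subst (x ∈_) (sym eq) X.w∈W))
      , λ x∈B → X.u∉W (subst (y ∈_) eq (∈-preimage⁺ (subst (_∈ B) (sym (swap-y x y)) x∈B))))

exchangeIso : ∀ {n} (T : SignedTree n) (s : Fin n → Bool) {x y : Fin n}
  (x—y : TreePaths.Edge T x y) (deg-x : degree T x ≤ 2) (deg-y : degree T y ≤ 2) →
  sign T x ≡ false → sign T y ≡ true → s x ≡ true → s y ≡ false →
  (∀ {v} → v ≢ x → v ≢ y → s v ≡ sign T v) → BlockIso T (withSigns T s)
exchangeIso T s x—y deg-x deg-y x⁻ y⁺ s-x s-y s-other = record
  { to = Forth.exchangeMap ; from = Back.exchangeMap
  ; from∘to = Forth.exchange-inverse ; to∘from = Back.exchange-inverse }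
  where
  module Forth = Exchange T s x—y deg-x deg-y x⁻ y⁺ s-x s-y s-other
  module Back  = Exchange (withSigns T s) (sign T) (TreePaths.Edge-sym T x—y) deg-y deg-x s-y s-x y⁺ x⁻
                          (λ v≢y v≢x → sym (s-other v≢x v≢y))

exchangeSignsIso : ∀ {n} (T : SignedTree n) (s : Fin n → Bool) {x y : Fin n} →
  TreePaths.Edge T x y → degree T x ≤ 2 → degree T y ≤ 2 →
  s x ≡ sign T y → s y ≡ sign T x → (∀ {v} → v ≢ x → v ≢ y → s v ≡ sign T v) → BlockIso T (withSigns T s)
exchangeSignsIso T s {x} {y} x—y deg-x deg-y s-x s-y s-other = bySigns (sign T x) (sign T y) refl refl
  where
  unchangedIso : sign T x ≡ sign T y → BlockIso T (withSigns T s)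
  unchangedIso x≡y = interiorSignsIso (λ _ _ → refl) (λ {_} {_} {v} _ _ _ → unchanged v)
    where
    unchanged : ∀ v → s v ≡ sign T v
    unchanged v with swapCase x y v
    ... | is-x refl       = trans s-x (sym x≡y)
    ... | is-y refl       = trans s-y x≡y
    ... | other v≢x v≢y = s-other v≢x v≢y

  bySigns : ∀ σx σy → sign T x ≡ σx → sign T y ≡ σy → BlockIso T (withSigns T s)
  bySigns false true  x⁻ y⁺ = exchangeIso T s x—y deg-x deg-y x⁻ y⁺ (trans s-x y⁺) (trans s-y x⁻) s-other
  bySigns true  false x⁺ y⁻ = exchangeIso T s (TreePaths.Edge-sym T x—y) deg-y deg-x y⁻ x⁺ (trans s-y x⁺) (trans s-x y⁻)
                                          (λ v≢y v≢x → s-other v≢x v≢y)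
  bySigns false false x± y± = unchangedIso (trans x± (sym y±))
  bySigns true  true  x± y± = unchangedIso (trans x± (sym y±))

switchIso : ∀ {n} (T T′ : SignedTree n) (x y : Fin n) → adj T x y ≡ true → degree T x ≤ 2 → degree T y ≤ 2 →
            (∀ u v → adj T′ (swap x y u) (swap x y v) ≡ adj T u v) → (∀ v → sign T′ v ≡ sign T v) →
            BlockIso T T′
switchIso T T′ x y x—y deg-x deg-y swapped-adj same-sign = BlockIso-trans
  (exchangeSignsIso T (sign T ∘ swap x y) x—y deg-x deg-y
    (cong (sign T) (swap-x x y)) (cong (sign T) (swap-y x y))
    (λ v≢x v≢y → cong (sign T) (swap-other x y v≢x v≢y)))
  (relabelIso relabelling)
  where
  relabelling : SignedTreeIso (withSigns T (sign T ∘ swap x y)) T′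
  relabelling = record
    { to = swap x y ; from = swap y x ; from∘to = swap-swap x y ; to∘from = swap-swap y x
    ; adj-to = swapped-adj ; sign-to = same-sign ∘ swap x y }

leafIso : ∀ {n} (T T′ : SignedTree n) (ℓ : Fin n) → IsLeaf T ℓ → (∀ u v → adj T′ u v ≡ adj T u v) →
          (∀ v → v ≢ ℓ → sign T′ v ≡ sign T v) → BlockIso T T′
leafIso T T′ ℓ leaf same-adj same-sign = interiorSignsIso same-adj interior-unchanged
  where
  interior-unchanged : ∀ {a b v} → OnPath T a b v → v ≢ a → v ≢ b → sign T′ v ≡ sign T v
  interior-unchanged {v = v} o v≢a v≢b = same-sign v λ { refl → [ v≢a , v≢b ]′ (leaf-endpoint T leaf o) }

proposition18 : ∀ {n m} (T : SignedTree n) (T' : SignedTree m) →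
    Operation T T' → NestedIso T T'
proposition18 T T′ (flipAll _ _ same-adj flipped) = BlockIso⇒NestedIso (complementIso same-adj flipped)
proposition18 T T′ (relabel _ _ φ φ-adj φ-sign) = BlockIso⇒NestedIso (relabelIso (signedTreeIso φ φ-adj φ-sign))
proposition18 T T′ (automorphism _ _ φ φ-auto same-adj φ-sign) =
  -- φ maps T′ isomorphically onto T.
  BlockIso⇒NestedIso (relabelIso (SignedTreeIso.inverse
    (signedTreeIso φ (λ u v → trans (φ-auto u v) (sym (same-adj u v))) (sym ∘ φ-sign))))
proposition18 T T′ (flipLeaf _ _ ℓ leaf same-adj _ same-sign) = BlockIso⇒NestedIso (leafIso T T′ ℓ leaf same-adj same-sign)
proposition18 T T′ (switch _ _ x y x—y deg-x deg-y swapped-adj same-sign) =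
  BlockIso⇒NestedIso (switchIso T T′ x y x—y deg-x deg-y swapped-adj same-sign)
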